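{- For every integer $n \geq 2$ we have $\omega(s(n)) \leq (10n-2)/3$.
   Context: Let $(a(n))_{n\ge 0}$ be the Rudin-Shapiro sequence, defined by $a(0)=1$, $a(2n)=a(n)$, $a(2n+1)=(-1)^n a(n)$ for $n\ge 0$ (equivalently $a(n)=(-1)^{r_n}$ where $r_n$ is the number of possibly overlapping occurrences of $11$ in the binary representation of $n$). Let $s(n)=\sum_{0\le i\le n} a(i)$. For a positive integer $k$, $\omega(k)$ denotes the largest $n\ge 0$ with $s(n)=k$ (such $n$ exists for each value $k$ taken by $s$). -}

module Defs where

open import Data.Nat using (ℕ; zero; suc; _/_; _%_; _≤_; _*_)
open import Data.Integer using (ℤ; +_; -_) renaming (_+_ to _+ℤ_; _*_ to _*ℤ_)
open import Data.Product using (Σ; _×_)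
open import Relation.Binary.PropositionalEquality using (_≡_)

sgn : ℕ → ℤ
sgn m with m % 2
... | zero = + 1
... | suc _ = - (+ 1)

-- Fuel-based evaluation of the Rudin–Shapiro recursion:
--   a(0)=1, a(2m)=a(m), a(2m+1)=(-1)^m a(m).
-- With fuel ≥ n the fuel never runs out (n/2 < n for n > 0).
rsAux : ℕ → ℕ → ℤ
rsAux zero _ = + 1
rsAux (suc f) zero = + 1
rsAux (suc f) (suc k) with (suc k) % 2
... | zero = rsAux f (suc k / 2)
... | suc _ = sgn (suc k / 2) *ℤ rsAux f (suc k / 2)

rs : ℕ → ℤ
rs n = rsAux n n

s : ℕ → ℤ
s zero = rs zero
s (suc n) = s n +ℤ rs (suc n)

IsOmega : ℤ → ℕ → Set
IsOmega k w = (s w ≡ k) × (∀ m → s m ≡ k → m ≤ w)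

-- Let b(k) = (-1)^k a(k). Then a(2k) = b(2k) = a(k), a(2k+1) = b(k) and b(2k+1) = -b(k), and
-- summing over blocks of four gives s(4m + r) = 2 s(m) + c, where the carry c ∈ {0, ±1} depends
-- only on the digit r and the signs of a(m), b(m). So s(r + 4m) ≤ s(q + 4n) + d implies
-- s(m) ≤ s(n) + ⌊(c_q + d - c_r) / 2⌋, while 3(r + 4m) - 10(q + 4n) = 4(3m - 10n) + 3r - 10q.
-- Hence a bound on 3m - 10n depending only on d ∈ {-2, …, 1}, the signs of a and b at m and n,
-- and whether n is 0, 1 or larger, passes from (m, n) to (r + 4m, q + 4n) as soon as its entries
-- satisfy finitely many linear inequalities. The least such table is checked by evaluation; for
-- d = 0 and n ≥ 2 all its entries are at most -2, so s(m) = s(n) forces 3m + 2 ≤ 10n.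

{-# OPTIONS --safe #-}
module Submission where

open import Defs
open import Data.Nat using (ℕ; _≤_; _*_; _+_)
open import Data.Product using (Σ; _×_)

open import Data.Nat using (zero; suc; z≤n; s≤s; _<_; _/_; _%_)
import Data.Nat.Properties as ℕP
open import Data.Nat.DivMod using (m*n%n≡0; [m+kn]%n≡m%n; m*n/n≡m; +-distrib-/; m/n<m)
open import Data.Nat.Induction using (<-rec)
import Data.Nat.Tactic.RingSolver as ℕ-Solver
open import Data.Integer as ℤ
  using (ℤ; +_; -[1+_]; -_; ∣_∣; sign; _◃_; +≤+; -≤+)
  renaming (_+_ to _+ℤ_; _-_ to _-ℤ_; _*_ to _*ℤ_; _≤_ to _≤ℤ_; _≤?_ to _≤ℤ?_)
import Data.Integer.Properties as ℤP
open import Agda.Builtin.FromNeg using (Negative)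
open import Data.Integer.Literals using (negative)
import Data.Integer.Tactic.RingSolver as ℤ-Solver
open import Data.Sign using (Sign; opposite) renaming (+ to ⁺; - to ⁻)
open import Data.List using (List; _∷_; [])
open import Data.List.Relation.Unary.Any using (here; there)
import Data.List.Relation.Unary.All as All
open import Data.List.Relation.Unary.Enumerates.Setoid using (IsEnumeration)
open import Data.Empty using (⊥)
open import Data.Unit using (⊤; tt)
open import Data.Product using (_,_)
open import Data.Sum using (_⊎_; inj₁; inj₂)
open import Relation.Nullary using (Dec; yes; no)
open import Relation.Nullary.Decidable using (map′; from-yes)
open import Relation.Unary using (Decidable)
open import Relation.Binary.PropositionalEquality
open import Function using (_∘_)

instance
  ℤ-negative : Negative ℤ
  ℤ-negative = negative

-- The Rudin–Shapiro sequence in base 4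

[2k]%2≡0 : ∀ k → 2 * k % 2 ≡ 0
[2k]%2≡0 k = trans (cong (_% 2) (ℕP.*-comm 2 k)) (m*n%n≡0 k 2)

[1+2k]%2≡1 : ∀ k → (1 + 2 * k) % 2 ≡ 1
[1+2k]%2≡1 k = trans (cong (λ j → (1 + j) % 2) (ℕP.*-comm 2 k)) ([m+kn]%n≡m%n 1 k 2)

[2k]/2≡k : ∀ k → 2 * k / 2 ≡ k
[2k]/2≡k k = trans (cong (_/ 2) (ℕP.*-comm 2 k)) (m*n/n≡m k 2)

[1+2k]/2≡k : ∀ k → (1 + 2 * k) / 2 ≡ k
[1+2k]/2≡k k =
  trans (+-distrib-/ 1 (2 * k) (subst (λ j → 1 + j < 2) (sym ([2k]%2≡0 k)) ℕP.≤-refl)) ([2k]/2≡k k)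

[1+k]/2≤k : ∀ k → suc k / 2 ≤ k
[1+k]/2≤k k = ℕP.≤-pred (m/n<m (suc k) 2 ℕP.≤-refl)

sgn-2k : ∀ k → sgn (2 * k) ≡ + 1
sgn-2k k rewrite [2k]%2≡0 k = refl

sgn-1+2k : ∀ k → sgn (1 + 2 * k) ≡ - + 1
sgn-1+2k k rewrite [1+2k]%2≡1 k = refl

∣sgn∣≡1 : ∀ k → ∣ sgn k ∣ ≡ 1
∣sgn∣≡1 k with k % 2
... | zero  = refl
... | suc _ = refl

rsAux-suc-cong : ∀ {f g} k → rsAux f (suc k / 2) ≡ rsAux g (suc k / 2) →
                 rsAux (suc f) (suc k) ≡ rsAux (suc g) (suc k)
rsAux-suc-cong k eq with suc k % 2
... | zero  = eq
... | suc _ = cong (sgn (suc k / 2) *ℤ_) eq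

rsAux-fuel : ∀ {f g n} → n ≤ f → n ≤ g → rsAux f n ≡ rsAux g n
rsAux-fuel {zero}  {zero}  {zero} _ _ = refl
rsAux-fuel {zero}  {suc _} {zero} _ _ = refl
rsAux-fuel {suc _} {zero}  {zero} _ _ = refl
rsAux-fuel {suc _} {suc _} {zero} _ _ = refl
rsAux-fuel {suc f} {suc g} {suc k} (s≤s k<f) (s≤s k<g) = rsAux-suc-cong k
  (rsAux-fuel (ℕP.≤-trans ([1+k]/2≤k k) k<f) (ℕP.≤-trans ([1+k]/2≤k k) k<g))

∣rsAux∣≡1 : ∀ f n → ∣ rsAux f n ∣ ≡ 1
∣rsAux∣≡1 zero    _       = refl
∣rsAux∣≡1 (suc f) zero    = refl
∣rsAux∣≡1 (suc f) (suc k) with suc k % 2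
... | zero  = ∣rsAux∣≡1 f (suc k / 2)
... | suc _ = begin
  ∣ sgn h *ℤ rsAux f h ∣        ≡⟨ ℤP.abs-* (sgn h) (rsAux f h) ⟩
  ∣ sgn h ∣ * ∣ rsAux f h ∣     ≡⟨ cong₂ _*_ (∣sgn∣≡1 h) (∣rsAux∣≡1 f h) ⟩
  1                             ∎
  where
  open ≡-Reasoning
  h : ℕ
  h = suc k / 2

∣rs∣≡1 : ∀ n → ∣ rs n ∣ ≡ 1
∣rs∣≡1 n = ∣rsAux∣≡1 n n

rs-even : ∀ n → n % 2 ≡ 0 → rs n ≡ rs (n / 2)
rs-even zero    _ = refl
rs-even (suc k) p rewrite p = rsAux-fuel ([1+k]/2≤k k) ℕP.≤-refl

rs-odd : ∀ n → n % 2 ≡ 1 → rs n ≡ sgn (n / 2) *ℤ rs (n / 2)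
rs-odd (suc k) p rewrite p = cong (sgn (suc k / 2) *ℤ_) (rsAux-fuel ([1+k]/2≤k k) ℕP.≤-refl)

rs-2k : ∀ k → rs (2 * k) ≡ rs k
rs-2k k = trans (rs-even (2 * k) ([2k]%2≡0 k)) (cong rs ([2k]/2≡k k))

twistedRs : ℕ → ℤ
twistedRs k = sgn k *ℤ rs k

∣twistedRs∣≡1 : ∀ k → ∣ twistedRs k ∣ ≡ 1
∣twistedRs∣≡1 k = trans (ℤP.abs-* (sgn k) (rs k)) (cong₂ _*_ (∣sgn∣≡1 k) (∣rs∣≡1 k))

rs-1+2k : ∀ k → rs (1 + 2 * k) ≡ twistedRs k
rs-1+2k k = trans (rs-odd (1 + 2 * k) ([1+2k]%2≡1 k)) (cong twistedRs ([1+2k]/2≡k k))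

twistedRs-2k : ∀ k → twistedRs (2 * k) ≡ rs k
twistedRs-2k k = trans (cong₂ _*ℤ_ (sgn-2k k) (rs-2k k)) (ℤP.*-identityˡ (rs k))

twistedRs-1+2k : ∀ k → twistedRs (1 + 2 * k) ≡ - twistedRs k
twistedRs-1+2k k = trans (cong₂ _*ℤ_ (sgn-1+2k k) (rs-1+2k k)) (ℤP.-1*i≡-i (twistedRs k))

4m≡2[2m] : ∀ m → 4 * m ≡ 2 * (2 * m)
4m≡2[2m] m = ℕP.*-assoc 2 2 m

2+4m≡2[1+2m] : ∀ m → 2 + 4 * m ≡ 2 * (1 + 2 * m)
2+4m≡2[1+2m] m = trans (cong (λ j → 2 + j) (4m≡2[2m] m)) (sym (ℕP.*-distribˡ-+ 2 1 (2 * m)))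

rs-4m : ∀ m → rs (4 * m) ≡ rs m
rs-4m m = trans (cong rs (4m≡2[2m] m)) (trans (rs-2k (2 * m)) (rs-2k m))

rs-1+4m : ∀ m → rs (1 + 4 * m) ≡ rs m
rs-1+4m m = trans (cong (rs ∘ suc) (4m≡2[2m] m)) (trans (rs-1+2k (2 * m)) (twistedRs-2k m))

rs-2+4m : ∀ m → rs (2 + 4 * m) ≡ twistedRs m
rs-2+4m m = trans (cong rs (2+4m≡2[1+2m] m)) (trans (rs-2k (1 + 2 * m)) (rs-1+2k m))

rs-3+4m : ∀ m → rs (3 + 4 * m) ≡ - twistedRs m
rs-3+4m m =
  trans (cong (rs ∘ suc) (2+4m≡2[1+2m] m)) (trans (rs-1+2k (1 + 2 * m)) (twistedRs-1+2k m))

twistedRs-4m : ∀ m → twistedRs (4 * m) ≡ rs m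
twistedRs-4m m = trans (cong twistedRs (4m≡2[2m] m)) (trans (twistedRs-2k (2 * m)) (rs-2k m))

twistedRs-1+4m : ∀ m → twistedRs (1 + 4 * m) ≡ - rs m
twistedRs-1+4m m = trans (cong (twistedRs ∘ suc) (4m≡2[2m] m))
  (trans (twistedRs-1+2k (2 * m)) (cong -_ (twistedRs-2k m)))

twistedRs-2+4m : ∀ m → twistedRs (2 + 4 * m) ≡ twistedRs m
twistedRs-2+4m m = trans (cong twistedRs (2+4m≡2[1+2m] m))
  (trans (twistedRs-2k (1 + 2 * m)) (rs-1+2k m))

twistedRs-3+4m : ∀ m → twistedRs (3 + 4 * m) ≡ twistedRs m
twistedRs-3+4m m = trans (cong (twistedRs ∘ suc) (2+4m≡2[1+2m] m))
  (trans (twistedRs-1+2k (1 + 2 * m))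
    (trans (cong -_ (twistedRs-1+2k m)) (ℤP.neg-involutive (twistedRs m))))

-- Partial sums in base 4

s-pred : ∀ n → s n ≡ s (suc n) -ℤ rs (suc n)
s-pred n = x≡[x+y]-y (s n) (rs (suc n))
  where
  x≡[x+y]-y : ∀ x y → x ≡ (x +ℤ y) -ℤ y
  x≡[x+y]-y = ℤ-Solver.solve-∀

s-3+4[1+m] : ∀ m → s (3 + 4 * suc m) ≡ s (3 + 4 * m) +ℤ
  (rs (4 * suc m) +ℤ rs (1 + 4 * suc m) +ℤ rs (2 + 4 * suc m) +ℤ rs (3 + 4 * suc m))
s-3+4[1+m] m = begin
  s (3 + 4 * suc m)
    ≡⟨ cong (λ j → s (3 + j)) (ℕP.*-suc 4 m) ⟩
  s (3 + 4 * m) +ℤ rs (4 + 4 * m) +ℤ rs (5 + 4 * m) +ℤ rs (6 + 4 * m) +ℤ rs (7 + 4 * m)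
    ≡⟨ reassociate (s (3 + 4 * m)) (rs (4 + 4 * m)) (rs (5 + 4 * m))
                   (rs (6 + 4 * m)) (rs (7 + 4 * m)) ⟩
  s (3 + 4 * m) +ℤ (rs (4 + 4 * m) +ℤ rs (5 + 4 * m) +ℤ rs (6 + 4 * m) +ℤ rs (7 + 4 * m))
    ≡⟨ cong (λ j → s (3 + 4 * m) +ℤ (rs j +ℤ rs (1 + j) +ℤ rs (2 + j) +ℤ rs (3 + j)))
            (sym (ℕP.*-suc 4 m)) ⟩
  s (3 + 4 * m) +ℤ
    (rs (4 * suc m) +ℤ rs (1 + 4 * suc m) +ℤ rs (2 + 4 * suc m) +ℤ rs (3 + 4 * suc m)) ∎
  where
  open ≡-Reasoning
  reassociate : ∀ x a b c d → x +ℤ a +ℤ b +ℤ c +ℤ d ≡ x +ℤ (a +ℤ b +ℤ c +ℤ d)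
  reassociate = ℤ-Solver.solve-∀

s-3+4m : ∀ m → s (3 + 4 * m) ≡ s m +ℤ s m
s-3+4m zero    = refl
s-3+4m (suc m) = begin
  s (3 + 4 * suc m)
    ≡⟨ s-3+4[1+m] m ⟩
  s (3 + 4 * m) +ℤ
    (rs (4 * suc m) +ℤ rs (1 + 4 * suc m) +ℤ rs (2 + 4 * suc m) +ℤ rs (3 + 4 * suc m))
    ≡⟨ cong₂ _+ℤ_ (s-3+4m m) (cong₂ _+ℤ_ (cong₂ _+ℤ_ (cong₂ _+ℤ_
         (rs-4m (suc m)) (rs-1+4m (suc m))) (rs-2+4m (suc m))) (rs-3+4m (suc m))) ⟩
  (s m +ℤ s m) +ℤ (rs (suc m) +ℤ rs (suc m) +ℤ twistedRs (suc m) +ℤ - twistedRs (suc m))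
    ≡⟨ regroup (s m) (rs (suc m)) (twistedRs (suc m)) ⟩
  s (suc m) +ℤ s (suc m) ∎
  where
  open ≡-Reasoning
  regroup : ∀ x a b → (x +ℤ x) +ℤ (a +ℤ a +ℤ b +ℤ - b) ≡ (x +ℤ a) +ℤ (x +ℤ a)
  regroup = ℤ-Solver.solve-∀

s-2+4m : ∀ m → s (2 + 4 * m) ≡ (s m +ℤ s m) +ℤ twistedRs m
s-2+4m m = begin
  s (2 + 4 * m)                           ≡⟨ s-pred (2 + 4 * m) ⟩
  s (3 + 4 * m) -ℤ rs (3 + 4 * m)         ≡⟨ cong₂ _-ℤ_ (s-3+4m m) (rs-3+4m m) ⟩
  (s m +ℤ s m) -ℤ - twistedRs m           ≡⟨ cong ((s m +ℤ s m) +ℤ_) (ℤP.neg-involutive _) ⟩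
  (s m +ℤ s m) +ℤ twistedRs m             ∎
  where open ≡-Reasoning

s-1+4m : ∀ m → s (1 + 4 * m) ≡ s m +ℤ s m
s-1+4m m = begin
  s (1 + 4 * m)                                ≡⟨ s-pred (1 + 4 * m) ⟩
  s (2 + 4 * m) -ℤ rs (2 + 4 * m)              ≡⟨ cong₂ _-ℤ_ (s-2+4m m) (rs-2+4m m) ⟩
  (s m +ℤ s m) +ℤ twistedRs m -ℤ twistedRs m   ≡⟨ x+y-y≡x (s m +ℤ s m) (twistedRs m) ⟩
  s m +ℤ s m                                   ∎
  where
  open ≡-Reasoning
  x+y-y≡x : ∀ x y → x +ℤ y -ℤ y ≡ x
  x+y-y≡x = ℤ-Solver.solve-∀

s-4m : ∀ m → s (4 * m) ≡ (s m +ℤ s m) -ℤ rs m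
s-4m m = begin
  s (4 * m)                          ≡⟨ s-pred (4 * m) ⟩
  s (1 + 4 * m) -ℤ rs (1 + 4 * m)    ≡⟨ cong₂ _-ℤ_ (s-1+4m m) (rs-1+4m m) ⟩
  (s m +ℤ s m) -ℤ rs m               ∎
  where open ≡-Reasoning

◃-inverse-unit : ∀ {i} → ∣ i ∣ ≡ 1 → sign i ◃ 1 ≡ i
◃-inverse-unit {i} ∣i∣≡1 = subst (λ k → sign i ◃ k ≡ i) ∣i∣≡1 (ℤP.◃-inverse i)

sign-neg-unit : ∀ {i} → ∣ i ∣ ≡ 1 → sign (- i) ≡ opposite (sign i)
sign-neg-unit {+ _}      refl = refl
sign-neg-unit { -[1+ _ ]} refl = refl

data Digit : Set where
  d0 d1 d2 d3 : Digit

digit : Digit → ℕ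
digit d0 = 0
digit d1 = 1
digit d2 = 2
digit d3 = 3

data Base4 : ℕ → Set where
  _∷₄_ : (r : Digit) (m : ℕ) → Base4 (digit r + 4 * m)

base4 : ∀ n → Base4 n
base4 zero = d0 ∷₄ 0
base4 (suc n) with base4 n
... | d0 ∷₄ m = d1 ∷₄ m
... | d1 ∷₄ m = d2 ∷₄ m
... | d2 ∷₄ m = d3 ∷₄ m
... | d3 ∷₄ m = subst Base4 (ℕP.*-suc 4 m) (d0 ∷₄ (suc m))

Signs : Set
Signs = Sign × Sign

signs : ℕ → Signs
signs m = sign (rs m) , sign (twistedRs m)

childSigns : Signs → Digit → Signs
childSigns (α , β) d0 = α , α
childSigns (α , β) d1 = α , opposite α
childSigns (α , β) d2 = β , β
childSigns (α , β) d3 = opposite β , β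

carry : Signs → Digit → ℤ
carry (α , β) d0 = - (α ◃ 1)
carry (α , β) d1 = + 0
carry (α , β) d2 = β ◃ 1
carry (α , β) d3 = + 0

signs-base4 : ∀ r m → signs (digit r + 4 * m) ≡ childSigns (signs m) r
signs-base4 d0 m = cong₂ _,_ (cong sign (rs-4m m)) (cong sign (twistedRs-4m m))
signs-base4 d1 m = cong₂ _,_ (cong sign (rs-1+4m m))
  (trans (cong sign (twistedRs-1+4m m)) (sign-neg-unit (∣rs∣≡1 m)))
signs-base4 d2 m = cong₂ _,_ (cong sign (rs-2+4m m)) (cong sign (twistedRs-2+4m m))
signs-base4 d3 m = cong₂ _,_
  (trans (cong sign (rs-3+4m m)) (sign-neg-unit (∣twistedRs∣≡1 m))) (cong sign (twistedRs-3+4m m))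

s-base4 : ∀ r m → s (digit r + 4 * m) ≡ (s m +ℤ s m) +ℤ carry (signs m) r
s-base4 d0 m = trans (s-4m m) (cong (λ x → (s m +ℤ s m) -ℤ x) (sym (◃-inverse-unit (∣rs∣≡1 m))))
s-base4 d1 m = trans (s-1+4m m) (sym (ℤP.+-identityʳ (s m +ℤ s m)))
s-base4 d2 m = trans (s-2+4m m) (cong ((s m +ℤ s m) +ℤ_) (sym (◃-inverse-unit (∣twistedRs∣≡1 m))))
s-base4 d3 m = trans (s-3+4m m) (sym (ℤP.+-identityʳ (s m +ℤ s m)))

data Size : Set where
  nil one many : Size

sizeOf : ℕ → Size
sizeOf zero             = nil
sizeOf (suc zero)       = one
sizeOf (suc (suc _))    = many

childSize : Size → Digit → Size
childSize nil d0 = nil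
childSize nil d1 = one
childSize _   _  = many

sizeOf-≥2 : ∀ {n} → 2 ≤ n → sizeOf n ≡ many
sizeOf-≥2 (s≤s (s≤s _)) = refl

size-base4 : ∀ q n → sizeOf (digit q + 4 * n) ≡ childSize (sizeOf n) q
size-base4 d0 zero    = refl
size-base4 d1 zero    = refl
size-base4 d2 zero    = refl
size-base4 d3 zero    = refl
size-base4 q  (suc n) = trans (sizeOf-≥2 2≤4[1+n]) (sym (childSize-positive n))
  where
  2≤4[1+n] : 2 ≤ digit q + 4 * suc n
  2≤4[1+n] = ℕP.≤-trans (s≤s (s≤s z≤n))
    (ℕP.≤-trans (ℕP.*-monoʳ-≤ 4 (s≤s z≤n)) (ℕP.m≤n+m (4 * suc n) (digit q)))
  childSize-positive : ∀ n → childSize (sizeOf (suc n)) q ≡ many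
  childSize-positive zero    = refl
  childSize-positive (suc _) = refl

data Offset : Set where
  o₋₂ o₋₁ o₀ o₁ : Offset

offset : Offset → ℤ
offset o₋₂ = -2
offset o₋₁ = -1
offset o₀  = + 0
offset o₁  = + 1

halve : ℤ → Offset
halve (+ 0)      = o₀
halve (+ 1)      = o₀
halve (+ _)      = o₁
halve -[1+ 0 ]   = o₋₁
halve -[1+ 1 ]   = o₋₁
halve -[1+ _ ]   = o₋₂

-- By s-base4, s (r + 4m) ≤ s (q + 4n) + d says 2 (s m - s n) ≤ slack d σ τ r q.
slack : Offset → Signs → Signs → Digit → Digit → ℤ
slack d σ τ r q = (carry τ q +ℤ offset d) -ℤ carry σ r

parentOffset : Offset → Signs → Signs → Digit → Digit → Offset
parentOffset d σ τ r q = halve (slack d σ τ r q)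

i+i≤1⇒i≤0 : ∀ i → i +ℤ i ≤ℤ + 1 → i ≤ℤ + 0
i+i≤1⇒i≤0 (+ zero)  _               = +≤+ z≤n
i+i≤1⇒i≤0 (+ suc k) (+≤+ (s≤s k+k≤0)) with ℕP.m+n≤o⇒n≤o k k+k≤0
... | ()
i+i≤1⇒i≤0 -[1+ _ ] _               = -≤+

halve-≤ : ∀ {x y u v w h} → (x +ℤ x) +ℤ u ≤ℤ ((y +ℤ y) +ℤ v) +ℤ w →
          (v +ℤ w) -ℤ u ≤ℤ (h +ℤ h) +ℤ + 1 → x ≤ℤ y +ℤ h
halve-≤ {x} {y} {u} {v} {w} {h} lower upper = ℤP.i-j≤0⇒i≤j (i+i≤1⇒i≤0 _ (begin
  (x -ℤ (y +ℤ h)) +ℤ (x -ℤ (y +ℤ h))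
    ≡⟨ split x y u v w h ⟩
  ((x +ℤ x +ℤ u) -ℤ (y +ℤ y +ℤ v +ℤ w)) +ℤ ((v +ℤ w) -ℤ u -ℤ (h +ℤ h +ℤ + 1)) +ℤ + 1
    ≤⟨ ℤP.+-monoˡ-≤ (+ 1) (ℤP.+-mono-≤ (ℤP.i≤j⇒i-j≤0 lower) (ℤP.i≤j⇒i-j≤0 upper)) ⟩
  + 1 ∎))
  where
  open ℤP.≤-Reasoning
  split : ∀ x y u v w h → (x -ℤ (y +ℤ h)) +ℤ (x -ℤ (y +ℤ h)) ≡
    ((x +ℤ x +ℤ u) -ℤ (y +ℤ y +ℤ v +ℤ w)) +ℤ ((v +ℤ w) -ℤ u -ℤ (h +ℤ h +ℤ + 1)) +ℤ + 1
  split = ℤ-Solver.solve-∀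

-- Bounds on 3m - 10n

excess : ℕ → ℕ → ℤ
excess m n = + (3 * m) -ℤ + (10 * n)

excess-base4 : ∀ a b m n → excess (a + 4 * m) (b + 4 * n) ≡ + 4 *ℤ excess m n +ℤ excess a b
excess-base4 a b m n = begin
  + (3 * (a + 4 * m)) -ℤ + (10 * (b + 4 * n))
    ≡⟨ cong₂ _-ℤ_ (expand 3 a m) (expand 10 b n) ⟩
  (+ (3 * a) +ℤ + 4 *ℤ + (3 * m)) -ℤ (+ (10 * b) +ℤ + 4 *ℤ + (10 * n))
    ≡⟨ regroup (+ (3 * a)) (+ (3 * m)) (+ (10 * b)) (+ (10 * n)) ⟩
  + 4 *ℤ excess m n +ℤ excess a b ∎
  where
  open ≡-Reasoning
  expand : ∀ c x y → + (c * (x + 4 * y)) ≡ + (c * x) +ℤ + 4 *ℤ + (c * y)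
  expand c x y = begin
    + (c * (x + 4 * y))        ≡⟨ cong +_ (distrib c x y) ⟩
    + (c * x + 4 * (c * y))    ≡⟨ ℤP.pos-+ (c * x) (4 * (c * y)) ⟩
    + (c * x) +ℤ + (4 * (c * y)) ≡⟨ cong (+ (c * x) +ℤ_) (ℤP.pos-* 4 (c * y)) ⟩
    + (c * x) +ℤ + 4 *ℤ + (c * y) ∎
    where
    distrib : ∀ c x y → c * (x + 4 * y) ≡ c * x + 4 * (c * y)
    distrib = ℕ-Solver.solve-∀
  regroup : ∀ a m b n → (a +ℤ + 4 *ℤ m) -ℤ (b +ℤ + 4 *ℤ n) ≡ + 4 *ℤ (m -ℤ n) +ℤ (a -ℤ b)
  regroup = ℤ-Solver.solve-∀

excess≤-2⇒3m+2≤10n : ∀ {m n} → excess m n ≤ℤ -2 → 3 * m + 2 ≤ 10 * n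
excess≤-2⇒3m+2≤10n {m} {n} excess≤-2 = ℤP.drop‿+≤+ (ℤP.i-j≤0⇒i≤j (begin
  + (3 * m + 2) -ℤ + (10 * n)     ≡⟨ cong (_-ℤ + (10 * n)) (ℤP.pos-+ (3 * m) 2) ⟩
  (+ (3 * m) +ℤ + 2) -ℤ + (10 * n) ≡⟨ shift (+ (3 * m)) (+ (10 * n)) ⟩
  excess m n +ℤ + 2               ≤⟨ ℤP.+-monoˡ-≤ (+ 2) excess≤-2 ⟩
  + 0                             ∎))
  where
  open ℤP.≤-Reasoning
  shift : ∀ a b → (a +ℤ + 2) -ℤ b ≡ (a -ℤ b) +ℤ + 2
  shift = ℤ-Solver.solve-∀

data Bound : Set where
  none      : Bound
  atMost    : ℤ → Bound
  unbounded : Bound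

Holds : Bound → ℕ → ℕ → Set
Holds none       _ _ = ⊥
Holds (atMost e) m n = excess m n ≤ℤ e
Holds unbounded  _ _ = ⊤

data _≼_ : Bound → Bound → Set where
  none≼         : ∀ {b} → none ≼ b
  atMost≼atMost : ∀ {e e′} → e ≤ℤ e′ → atMost e ≼ atMost e′
  ≼unbounded    : ∀ {b} → b ≼ unbounded

_≼?_ : ∀ b b′ → Dec (b ≼ b′)
none      ≼? _          = yes none≼
atMost e  ≼? none       = no λ ()
atMost e  ≼? atMost e′  = map′ atMost≼atMost (λ { (atMost≼atMost e≤e′) → e≤e′ }) (e ≤ℤ? e′)
atMost e  ≼? unbounded  = yes ≼unbounded
unbounded ≼? none       = no λ ()
unbounded ≼? atMost _   = no λ ()
unbounded ≼? unbounded  = yes ≼unbounded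

holds-mono : ∀ {b b′ m n} → b ≼ b′ → Holds b m n → Holds b′ m n
holds-mono none≼                 ()
holds-mono (atMost≼atMost e≤e′) h = ℤP.≤-trans h e≤e′
holds-mono ≼unbounded            _ = tt

lift : Digit → Digit → Bound → Bound
lift r q none       = none
lift r q (atMost e) = atMost (+ 4 *ℤ e +ℤ excess (digit r) (digit q))
lift r q unbounded  = unbounded

holds-lift : ∀ r q b {m n} → Holds b m n → Holds (lift r q b) (digit r + 4 * m) (digit q + 4 * n)
holds-lift r q none       ()
holds-lift r q (atMost e) {m} {n} h =
  subst (_≤ℤ _) (sym (excess-base4 (digit r) (digit q) m n))
    (ℤP.+-monoˡ-≤ (excess (digit r) (digit q)) (ℤP.*-monoˡ-≤-nonNeg (+ 4) h))
holds-lift r q unbounded _ = tt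

-- The entry at (d , σ , τ , c) bounds excess m n whenever s m ≤ s n + offset d, signs m = σ,
-- signs n = τ and sizeOf n = c; `none` marks configurations that no pair (m , n) has. It is the
-- least table satisfying the descent constraints checked below, computed by fixpoint iteration
-- (`unbounded` where those constraints admit no finite value).
excessBound : Offset → Signs → Signs → Size → Bound
excessBound o₀  (⁺ , ⁺) (⁺ , ⁺) nil  = atMost (+ 0)
excessBound o₁  (⁺ , ⁺) (⁺ , ⁺) nil  = atMost (+ 0)
excessBound o₁  (⁺ , ⁻) (⁺ , ⁺) nil  = atMost (+ 3)
excessBound o₁  (⁻ , ⁺) (⁺ , ⁺) nil  = atMost (+ 9)
excessBound o₋₁ (⁺ , ⁺) (⁺ , ⁻) one  = atMost -10
excessBound o₀  (⁺ , ⁺) (⁺ , ⁻) one  = atMost -10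
excessBound o₀  (⁺ , ⁻) (⁺ , ⁻) one  = atMost -7
excessBound o₀  (⁻ , ⁺) (⁺ , ⁻) one  = atMost -1
excessBound o₁  (⁺ , ⁺) (⁺ , ⁻) one  = atMost (+ 2)
excessBound o₁  (⁺ , ⁻) (⁺ , ⁻) one  = atMost -7
excessBound o₁  (⁻ , ⁺) (⁺ , ⁻) one  = atMost -1
excessBound o₁  (⁻ , ⁻) (⁺ , ⁻) one  = atMost (+ 8)
excessBound o₋₂ (⁺ , ⁺) (⁺ , ⁺) many = atMost -20
excessBound o₋₂ (⁺ , ⁺) (⁺ , ⁻) many = atMost -50
excessBound o₋₂ (⁺ , ⁺) (⁻ , ⁺) many = atMost -98
excessBound o₋₂ (⁺ , ⁺) (⁻ , ⁻) many = atMost -60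
excessBound o₋₂ (⁺ , ⁻) (⁺ , ⁺) many = atMost -77
excessBound o₋₂ (⁺ , ⁻) (⁺ , ⁻) many = atMost -47
excessBound o₋₂ (⁺ , ⁻) (⁻ , ⁺) many = atMost -89
excessBound o₋₂ (⁺ , ⁻) (⁻ , ⁻) many = atMost -117
excessBound o₋₂ (⁻ , ⁺) (⁺ , ⁺) many = atMost -55
excessBound o₋₂ (⁻ , ⁺) (⁺ , ⁻) many = atMost -41
excessBound o₋₂ (⁻ , ⁺) (⁻ , ⁺) many = atMost -65
excessBound o₋₂ (⁻ , ⁺) (⁻ , ⁻) many = atMost -111
excessBound o₋₂ (⁻ , ⁻) (⁺ , ⁺) many = atMost -22
excessBound o₋₂ (⁻ , ⁻) (⁺ , ⁻) many = atMost -52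
excessBound o₋₂ (⁻ , ⁻) (⁻ , ⁺) many = atMost -92
excessBound o₋₂ (⁻ , ⁻) (⁻ , ⁻) many = atMost -62
excessBound o₋₁ (⁺ , ⁺) (⁺ , ⁺) many = atMost -20
excessBound o₋₁ (⁺ , ⁺) (⁺ , ⁻) many = atMost -38
excessBound o₋₁ (⁺ , ⁺) (⁻ , ⁺) many = atMost -30
excessBound o₋₁ (⁺ , ⁺) (⁻ , ⁻) many = atMost -60
excessBound o₋₁ (⁺ , ⁻) (⁺ , ⁺) many = atMost -17
excessBound o₋₁ (⁺ , ⁻) (⁺ , ⁻) many = atMost -47
excessBound o₋₁ (⁺ , ⁻) (⁻ , ⁺) many = atMost -89
excessBound o₋₁ (⁺ , ⁻) (⁻ , ⁻) many = atMost -57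
excessBound o₋₁ (⁻ , ⁺) (⁺ , ⁺) many = atMost -11
excessBound o₋₁ (⁻ , ⁺) (⁺ , ⁻) many = atMost -41
excessBound o₋₁ (⁻ , ⁺) (⁻ , ⁺) many = atMost -65
excessBound o₋₁ (⁻ , ⁺) (⁻ , ⁻) many = atMost -51
excessBound o₋₁ (⁻ , ⁻) (⁺ , ⁺) many = atMost -22
excessBound o₋₁ (⁻ , ⁻) (⁺ , ⁻) many = atMost -12
excessBound o₋₁ (⁻ , ⁻) (⁻ , ⁺) many = atMost -32
excessBound o₋₁ (⁻ , ⁻) (⁻ , ⁻) many = atMost -62
excessBound o₀  (⁺ , ⁺) (⁺ , ⁺) many = atMost -8
excessBound o₀  (⁺ , ⁺) (⁺ , ⁻) many = atMost -38
excessBound o₀  (⁺ , ⁺) (⁻ , ⁺) many = atMost -30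
excessBound o₀  (⁺ , ⁺) (⁻ , ⁻) many = atMost -48
excessBound o₀  (⁺ , ⁻) (⁺ , ⁺) many = atMost -17
excessBound o₀  (⁺ , ⁻) (⁺ , ⁻) many = atMost -9
excessBound o₀  (⁺ , ⁻) (⁻ , ⁺) many = atMost -27
excessBound o₀  (⁺ , ⁻) (⁻ , ⁻) many = atMost -57
excessBound o₀  (⁻ , ⁺) (⁺ , ⁺) many = atMost -11
excessBound o₀  (⁻ , ⁺) (⁺ , ⁻) many = atMost -5
excessBound o₀  (⁻ , ⁺) (⁻ , ⁺) many = atMost -21
excessBound o₀  (⁻ , ⁺) (⁻ , ⁻) many = atMost -51
excessBound o₀  (⁻ , ⁻) (⁺ , ⁺) many = atMost -2
excessBound o₀  (⁻ , ⁻) (⁺ , ⁻) many = atMost -12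
excessBound o₀  (⁻ , ⁻) (⁻ , ⁺) many = atMost -32
excessBound o₀  (⁻ , ⁻) (⁻ , ⁻) many = atMost -42
excessBound o₁  (⁺ , ⁺) (⁺ , ⁺) many = atMost -8
excessBound o₁  (⁺ , ⁺) (⁺ , ⁻) many = atMost -2
excessBound o₁  (⁺ , ⁺) (⁻ , ⁺) many = atMost -18
excessBound o₁  (⁺ , ⁺) (⁻ , ⁻) many = atMost -48
excessBound o₁  (⁺ , ⁻) (⁺ , ⁺) many = atMost (+ 1)
excessBound o₁  (⁺ , ⁻) (⁺ , ⁻) many = atMost -9
excessBound o₁  (⁺ , ⁻) (⁻ , ⁺) many = atMost -27
excessBound o₁  (⁺ , ⁻) (⁻ , ⁻) many = atMost -39
excessBound o₁  (⁻ , ⁺) (⁺ , ⁺) many = unbounded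
excessBound o₁  (⁻ , ⁺) (⁺ , ⁻) many = atMost -5
excessBound o₁  (⁻ , ⁺) (⁻ , ⁺) many = atMost -21
excessBound o₁  (⁻ , ⁺) (⁻ , ⁻) many = atMost -15
excessBound o₁  (⁻ , ⁻) (⁺ , ⁺) many = atMost -2
excessBound o₁  (⁻ , ⁻) (⁺ , ⁻) many = unbounded
excessBound o₁  (⁻ , ⁻) (⁻ , ⁺) many = atMost -12
excessBound o₁  (⁻ , ⁻) (⁻ , ⁻) many = atMost -42
excessBound _   _       _       _    = none

∀? : ∀ {A : Set} {P : A → Set} {xs : List A} →
     IsEnumeration (setoid A) xs → Decidable P → Dec (∀ x → P x)
∀? {xs = xs} enumerates P? =
  map′ (λ all x → All.lookup all (enumerates x)) (λ p → All.tabulate (λ {x} _ → p x))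
       (All.all? P? xs)

offset-enum : IsEnumeration (setoid Offset) (o₋₂ ∷ o₋₁ ∷ o₀ ∷ o₁ ∷ [])
offset-enum o₋₂ = here refl
offset-enum o₋₁ = there (here refl)
offset-enum o₀  = there (there (here refl))
offset-enum o₁  = there (there (there (here refl)))

signs-enum : IsEnumeration (setoid Signs) ((⁺ , ⁺) ∷ (⁺ , ⁻) ∷ (⁻ , ⁺) ∷ (⁻ , ⁻) ∷ [])
signs-enum (⁺ , ⁺) = here refl
signs-enum (⁺ , ⁻) = there (here refl)
signs-enum (⁻ , ⁺) = there (there (here refl))
signs-enum (⁻ , ⁻) = there (there (there (here refl)))

size-enum : IsEnumeration (setoid Size) (nil ∷ one ∷ many ∷ [])
size-enum nil  = here refl
size-enum one  = there (here refl)
size-enum many = there (there (here refl))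

digit-enum : IsEnumeration (setoid Digit) (d0 ∷ d1 ∷ d2 ∷ d3 ∷ [])
digit-enum d0 = here refl
digit-enum d1 = there (here refl)
digit-enum d2 = there (there (here refl))
digit-enum d3 = there (there (there (here refl)))

parentOffset-sound : ∀ d σ τ r q →
  let d′ = parentOffset d σ τ r q in slack d σ τ r q ≤ℤ (offset d′ +ℤ offset d′) +ℤ + 1
parentOffset-sound = from-yes
  (∀? offset-enum λ d → ∀? signs-enum λ σ → ∀? signs-enum λ τ →
   ∀? digit-enum λ r → ∀? digit-enum λ q →
    let d′ = parentOffset d σ τ r q in slack d σ τ r q ≤ℤ? (offset d′ +ℤ offset d′) +ℤ + 1)

excessBound-inherited : ∀ d σ τ c r q →
  lift r q (excessBound (parentOffset d σ τ r q) σ τ c)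
    ≼ excessBound d (childSigns σ r) (childSigns τ q) (childSize c q)
excessBound-inherited = from-yes
  (∀? offset-enum λ d → ∀? signs-enum λ σ → ∀? signs-enum λ τ → ∀? size-enum λ c →
   ∀? digit-enum λ r → ∀? digit-enum λ q →
    lift r q (excessBound (parentOffset d σ τ r q) σ τ c)
      ≼? excessBound d (childSigns σ r) (childSigns τ q) (childSize c q))

excessBound-o₀-many≤-2 : ∀ σ τ → excessBound o₀ σ τ many ≼ atMost -2
excessBound-o₀-many≤-2 = from-yes
  (∀? signs-enum λ σ → ∀? signs-enum λ τ → excessBound o₀ σ τ many ≼? atMost -2)

-- Induction on m + n

Excess≤Bound : ℕ → ℕ → Set
Excess≤Bound m n =
  ∀ d → s m ≤ℤ s n +ℤ offset d → Holds (excessBound d (signs m) (signs n) (sizeOf n)) m n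

excess≤bound-origin : Excess≤Bound 0 0
excess≤bound-origin o₋₂ ()
excess≤bound-origin o₋₁ (+≤+ ())
excess≤bound-origin o₀  _ = +≤+ z≤n
excess≤bound-origin o₁  _ = +≤+ z≤n

excess≤bound-step : ∀ r m q n → Excess≤Bound m n →
                    Excess≤Bound (digit r + 4 * m) (digit q + 4 * n)
excess≤bound-step r m q n ih d sM≤sN+d
  rewrite signs-base4 r m | signs-base4 q n | size-base4 q n =
  holds-mono (excessBound-inherited d σ τ c r q) (holds-lift r q _ (ih d′ sm≤sn+d′))
  where
  σ τ : Signs
  σ = signs m
  τ = signs n
  c : Size
  c = sizeOf n
  d′ : Offset
  d′ = parentOffset d σ τ r q
  sm≤sn+d′ : s m ≤ℤ s n +ℤ offset d′
  sm≤sn+d′ = halve-≤ {s m} {s n} {carry σ r} {carry τ q} {offset d} {offset d′}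
    (subst₂ (λ x y → x ≤ℤ y +ℤ offset d) (s-base4 r m) (s-base4 q n) sM≤sN+d)
    (parentOffset-sound d σ τ r q)

base4-descent : ∀ r m → (r ≡ d0 × m ≡ 0) ⊎ m < digit r + 4 * m
base4-descent d0 zero    = inj₁ (refl , refl)
base4-descent d1 zero    = inj₂ (s≤s z≤n)
base4-descent d2 zero    = inj₂ (s≤s z≤n)
base4-descent d3 zero    = inj₂ (s≤s z≤n)
base4-descent r  (suc m) =
  inj₂ (ℕP.≤-trans (ℕP.m<m+n (suc m) {3 * suc m} (s≤s z≤n)) (ℕP.m≤n+m (4 * suc m) (digit r)))

≤-base4 : ∀ r m → m ≤ digit r + 4 * m
≤-base4 r m = ℕP.≤-trans (ℕP.m≤n*m m 4) (ℕP.m≤n+m (4 * m) (digit r))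

excess≤bound : ∀ m n → Excess≤Bound m n
excess≤bound m n = <-rec P step (m + n) m n refl
  where
  P : ℕ → Set
  P k = ∀ m n → m + n ≡ k → Excess≤Bound m n
  step : ∀ k → (∀ {j} → j < k → P j) → P k
  step _ ih m n refl with base4 m | base4 n
  ... | r ∷₄ m′ | q ∷₄ n′ with base4-descent r m′ | base4-descent q n′
  ...   | inj₁ (refl , refl) | inj₁ (refl , refl) = excess≤bound-origin
  ...   | inj₂ m′<m          | _                  =
    excess≤bound-step r m′ q n′ (ih (ℕP.+-mono-<-≤ m′<m (≤-base4 q n′)) m′ n′ refl)
  ...   | inj₁ (refl , refl) | inj₂ n′<n          =
    excess≤bound-step d0 0 q n′ (ih n′<n 0 n′ refl)

s≡⇒3m+2≤10n : ∀ m {n} → 2 ≤ n → s m ≡ s n → 3 * m + 2 ≤ 10 * n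
s≡⇒3m+2≤10n m {n} 2≤n sm≡sn =
  excess≤-2⇒3m+2≤10n {m} {n} (holds-mono (excessBound-o₀-many≤-2 (signs m) (signs n)) holds)
  where
  holds : Holds (excessBound o₀ (signs m) (signs n) many) m n
  holds = subst (λ c → Holds (excessBound o₀ (signs m) (signs n) c) m n) (sizeOf-≥2 2≤n)
    (excess≤bound m n o₀ (ℤP.≤-reflexive (trans sm≡sn (sym (ℤP.+-identityʳ (s n))))))

bounded⇒greatest : ∀ {P : ℕ → Set} → Decidable P → ∀ b {x} → P x → (∀ m → P m → m ≤ b) →
                   Σ ℕ λ w → P w × (∀ m → P m → m ≤ w)
bounded⇒greatest {P} P? zero    px bounded = 0 , subst P (ℕP.n≤0⇒n≡0 (bounded _ px)) px , bounded
bounded⇒greatest {P} P? (suc b) px bounded with P? (suc b)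
... | yes pb = suc b , pb , bounded
... | no ¬pb = bounded⇒greatest P? b px
  (λ m pm → ℕP.≤-pred (ℕP.≤∧≢⇒< (bounded m pm) λ { refl → ¬pb pm }))

mainTheorem1 : (n : ℕ) → 2 ≤ n → Σ ℕ (λ w → IsOmega (s n) w × (3 * w + 2 ≤ 10 * n))
mainTheorem1 n 2≤n
  with bounded⇒greatest (λ m → s m ℤ.≟ s n) (10 * n) {n} refl
         (λ m sm≡sn → ℕP.≤-trans (ℕP.≤-trans (ℕP.m≤n*m m 3) (ℕP.m≤m+n (3 * m) 2))
                                  (s≡⇒3m+2≤10n m 2≤n sm≡sn))
... | w , sw≡sn , maximal = w , (sw≡sn , maximal) , s≡⇒3m+2≤10n w 2≤n sw≡sn
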